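{- Let $A = H[a_0, a_1, \ldots, a_{2n-2}]$. Suppose that there are vertices $u_1$, $u_2$, $v_1$, and $v_2$ in a component $C$ of $G(A)$ such that $u_1+v_1=u_2+v_2 \in T_A$ and $v_2 \le v_1\le u_1 \le u_2$. Then \[\left|V(C) \cap \{k\in\mathbb{Z}\colon\, u_1\le k\le u_2\} \right| = \left|V(C)\cap \{k\in\mathbb{Z}\colon\, v_2\le k\le v_1\} \right|.\]
   Context: For real numbers $a_0,\ldots,a_{2n-2}$, $H[a_0,\ldots,a_{2n-2}]$ denotes the $n\times n$ Hankel matrix whose entry in row $i$, column $j$ (indexed $0,\ldots,n-1$) is $a_{i+j}$. For such $A$, $T_A=\{i\colon\, a_i\neq 0\}$ and $w_A(t)=a_t$. The weighted Hankel graph $G(A)$ is the edge-weighted graph (loops allowed) with vertex set $\{0,1,\ldots,n-1\}$, where $i$ and $j$ are adjacent iff $i+j\in T_A$, and the edge $ij$ has weight $w_A(i+j)$. A component is a maximal connected subgraph.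
   Formalization: The entries $a_0,\ldots,a_{2n-2}$ of the Hankel matrix are rational rather than real. -}

module Defs where

open import Data.Nat using (ℕ; _+_; _*_; _∸_; _<_)
open import Data.Fin using (Fin; toℕ; fromℕ<; _≤?_)
open import Data.Fin.Subset using (Subset; _∩_; ∣_∣; inside; outside)
open import Data.Vec using (tabulate)
open import Data.Product using (Σ; _×_)
open import Data.Rational using (ℚ; 0ℚ)
open import Relation.Nullary using (¬_; does)
open import Relation.Binary.PropositionalEquality using (_≡_)
open import Relation.Binary.Construct.Closure.ReflexiveTransitive using (Star)
open import Data.Bool using (_∧_; if_then_else_)

-- The entries a_0, …, a_{2n-2} of the n×n Hankel matrix A = H[a_0,…,a_{2n-2}].
HankelEntries : ℕ → Set
HankelEntries n = Fin (2 * n ∸ 1) → ℚ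

InT : {n : ℕ} → HankelEntries n → ℕ → Set
InT {n} a t = Σ (t < 2 * n ∸ 1) (λ h → ¬ (a (fromℕ< h) ≡ 0ℚ))

Adj : {n : ℕ} → HankelEntries n → Fin n → Fin n → Set
Adj {n} a i j = InT {n} a (toℕ i + toℕ j)

Connected : {n : ℕ} → HankelEntries n → Fin n → Fin n → Set
Connected {n} a = Star (Adj {n} a)

interval : {n : ℕ} → Fin n → Fin n → Subset n
interval lo hi = tabulate (λ k →
  if does (lo ≤? k) ∧ does (k ≤? hi) then inside else outside)

countIn : {n : ℕ} → Subset n → Fin n → Fin n → ℕ
countIn S lo hi = ∣ S ∩ interval lo hi ∣

{-# OPTIONS --safe #-}
-- Let s = u₁ + v₁ = u₂ + v₂ ∈ T_A. Whenever k + k' = s, the vertices k and k' are adjacent in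
-- G(A), so they lie in the same component; hence the reflection k ↦ s − k preserves membership
-- in C. It maps the interval [u₁, u₂] bijectively onto [v₂, v₁], so both intervals meet C in
-- equally many vertices.
module Submission where

open import Defs
open import Data.Nat using (ℕ; _+_)
open import Data.Fin using (Fin; toℕ; _≤_)
open import Data.Fin.Subset using (Subset; _∈_)
open import Data.Product using (_×_)
open import Function.Bundles using (_⇔_)
open import Relation.Binary.PropositionalEquality using (_≡_)

open import Data.Bool using (Bool; true; false; _∧_; if_then_else_)
open import Data.Bool.Properties using (∧-zeroʳ; ⇔→≡)
open import Data.Fin using (fromℕ<; _≤?_)
open import Data.Fin.Properties using (toℕ<n; toℕ-fromℕ<)
open import Data.Fin.Subset using (_∩_; ∣_∣; inside; outside)
open import Data.List using (_∷_; applyUpTo; applyDownFrom)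
open import Data.List.Properties using (reverse-applyUpTo)
open import Data.List.Relation.Binary.Permutation.Propositional using (↭-sym)
open import Data.List.Relation.Binary.Permutation.Propositional.Properties using (↭-reverse)
open import Data.Nat as ℕ using (zero; suc; _∸_; z≤n; s≤s; z<s; s<s)
open import Data.Nat.ListAction using (sum)
open import Data.Nat.ListAction.Properties using (sum-↭)
open import Data.Nat.Properties
  using ( ≤-reflexive; ≤-trans; ≤-<-trans; <-trans; <⇒≱; +-suc; +-comm; +-monoʳ-≤; +-cancelˡ-≡
        ; m≤m+n; m∸n≤m; m∸n+n≡m; m+[n∸m]≡n)
open import Data.Nat.Tactic.RingSolver using (solve-∀)
open import Data.Vec using ([]; _∷_; lookup)
open import Data.Vec.Properties using (lookup∘tabulate; []=⇒lookup; lookup⇒[]=)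
open import Function using (_∘_)
open import Function.Bundles using (Equivalence; mk⇔)
open import Relation.Binary.Construct.Closure.ReflexiveTransitive using (_◅◅_; return)
open import Relation.Binary.PropositionalEquality
  using (refl; sym; trans; cong; cong₂; subst; module ≡-Reasoning)
open import Relation.Nullary using (does)
open import Relation.Nullary.Decidable using (dec-true; dec-false)

private variable
  A : Set
  n : ℕ

applyUpTo-cong : ∀ {f g : ℕ → A} m → (∀ i → i ℕ.< m → f i ≡ g i) →
  applyUpTo f m ≡ applyUpTo g m
applyUpTo-cong zero    f≗g = refl
applyUpTo-cong (suc m) f≗g =
  cong₂ _∷_ (f≗g 0 z<s) (applyUpTo-cong m (λ i i<m → f≗g (suc i) (s<s i<m)))

applyDownFrom-applyUpTo : ∀ (f : ℕ → A) m →
  applyDownFrom f m ≡ applyUpTo (λ i → f (m ∸ suc i)) m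
applyDownFrom-applyUpTo f zero    = refl
applyDownFrom-applyUpTo f (suc m) = cong (f m ∷_) (applyDownFrom-applyUpTo f m)

sum-applyUpTo-reverse : ∀ (f : ℕ → ℕ) m →
  sum (applyUpTo f m) ≡ sum (applyUpTo (λ i → f (m ∸ suc i)) m)
sum-applyUpTo-reverse f m = trans (sum-↭ (↭-sym (↭-reverse (applyUpTo f m))))
  (cong sum (trans (reverse-applyUpTo f m) (applyDownFrom-applyUpTo f m)))

sum-applyUpTo-support : ∀ (f : ℕ → ℕ) l L {m} → l + L ℕ.≤ m →
  (∀ i → i ℕ.< l → f i ≡ 0) → (∀ i → l + L ℕ.≤ i → i ℕ.< m → f i ≡ 0) →
  sum (applyUpTo f m) ≡ sum (applyUpTo (f ∘ (l +_)) L)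
sum-applyUpTo-support f zero zero {zero} _ _ _ = refl
sum-applyUpTo-support f zero zero {suc m} _ _ after =
  cong₂ _+_ (after 0 z≤n z<s) (sum-applyUpTo-support (f ∘ suc) 0 0 z≤n (λ _ ())
    (λ i _ i<m → after (suc i) z≤n (s<s i<m)))
sum-applyUpTo-support f zero (suc L) {suc m} (s≤s L≤m) _ after =
  cong (f 0 +_) (sum-applyUpTo-support (f ∘ suc) 0 L L≤m (λ _ ())
    (λ i L≤i i<m → after (suc i) (s≤s L≤i) (s<s i<m)))
sum-applyUpTo-support f (suc l) L {suc m} (s≤s l+L≤m) before after =
  cong₂ _+_ (before 0 z<s) (sum-applyUpTo-support (f ∘ suc) l L l+L≤m
    (λ i i<l → before (suc i) (s<s i<l))
    (λ i l+L≤i i<m → after (suc i) (s≤s l+L≤i) (s<s i<m)))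

-- Natural numbers k ≥ n are never members of a subset of Fin n.
_∈ᵇ_ : ℕ → Subset n → Bool
k     ∈ᵇ []      = false
zero  ∈ᵇ (b ∷ p) = b
suc k ∈ᵇ (b ∷ p) = k ∈ᵇ p

χ : Subset n → ℕ → ℕ
χ p k = if k ∈ᵇ p then 1 else 0

∈ᵇ-lookup : (p : Subset n) {k : ℕ} (k<n : k ℕ.< n) → k ∈ᵇ p ≡ lookup p (fromℕ< k<n)
∈ᵇ-lookup (b ∷ p) {zero}  _         = refl
∈ᵇ-lookup (b ∷ p) {suc k} (s≤s k<n) = ∈ᵇ-lookup p k<n

∈⇔∈ᵇ : (p : Subset n) {k : ℕ} (k<n : k ℕ.< n) → (fromℕ< k<n ∈ p) ⇔ (k ∈ᵇ p ≡ true)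
∈⇔∈ᵇ p k<n = mk⇔ (λ k∈p → trans (∈ᵇ-lookup p k<n) ([]=⇒lookup k∈p))
                 (λ k∈ᵇp → lookup⇒[]= _ p (trans (sym (∈ᵇ-lookup p k<n)) k∈ᵇp))

∣p∣≡sum-χ : (p : Subset n) → ∣ p ∣ ≡ sum (applyUpTo (χ p) n)
∣p∣≡sum-χ []          = refl
∣p∣≡sum-χ (true  ∷ p) = cong suc (∣p∣≡sum-χ p)
∣p∣≡sum-χ (false ∷ p) = ∣p∣≡sum-χ p

χ-∩ : (p q : Subset n) (k : ℕ) → χ (p ∩ q) k ≡ (if k ∈ᵇ q then χ p k else 0)
χ-∩ []          []          k       = refl
χ-∩ (true  ∷ p) (c     ∷ q) zero    = refl
χ-∩ (false ∷ p) (true  ∷ q) zero    = refl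
χ-∩ (false ∷ p) (false ∷ q) zero    = refl
χ-∩ (b     ∷ p) (c     ∷ q) (suc k) = χ-∩ p q k

module _ (lo hi : Fin n) where

  ∈ᵇ-interval : {k : ℕ} (k<n : k ℕ.< n) → k ∈ᵇ interval lo hi ≡
    (if does (toℕ lo ℕ.≤? k) ∧ does (k ℕ.≤? toℕ hi) then inside else outside)
  ∈ᵇ-interval k<n = begin
      _ ∈ᵇ interval lo hi
    ≡⟨ ∈ᵇ-lookup (interval lo hi) k<n ⟩
      lookup (interval lo hi) x
    ≡⟨ lookup∘tabulate _ x ⟩
      (if does (lo ≤? x) ∧ does (x ≤? hi) then inside else outside)
    ≡⟨ cong (λ j → if does (toℕ lo ℕ.≤? j) ∧ does (j ℕ.≤? toℕ hi) then inside else outside)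
            (toℕ-fromℕ< k<n) ⟩
      _ ∎
    where
    open ≡-Reasoning
    x = fromℕ< k<n

  ∈ᵇ-interval-inside : {k : ℕ} → toℕ lo ℕ.≤ k → k ℕ.≤ toℕ hi →
    k ∈ᵇ interval lo hi ≡ true
  ∈ᵇ-interval-inside lo≤k k≤hi = trans (∈ᵇ-interval (≤-<-trans k≤hi (toℕ<n hi)))
    (cong₂ (λ b c → if b ∧ c then inside else outside)
      (dec-true (_ ℕ.≤? _) lo≤k) (dec-true (_ ℕ.≤? _) k≤hi))

  ∈ᵇ-interval-below : {k : ℕ} → k ℕ.< toℕ lo → k ∈ᵇ interval lo hi ≡ false
  ∈ᵇ-interval-below k<lo = trans (∈ᵇ-interval (<-trans k<lo (toℕ<n lo)))
    (cong (λ b → if b ∧ _ then inside else outside) (dec-false (_ ℕ.≤? _) (<⇒≱ k<lo)))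

  ∈ᵇ-interval-above : {k : ℕ} → toℕ hi ℕ.< k → k ℕ.< n → k ∈ᵇ interval lo hi ≡ false
  ∈ᵇ-interval-above {k} hi<k k<n = trans (∈ᵇ-interval k<n)
    (cong (if_then inside else outside)
      (trans (cong (does (toℕ lo ℕ.≤? k) ∧_) (dec-false (k ℕ.≤? _) (<⇒≱ hi<k))) (∧-zeroʳ _)))

countIn-window : (S : Subset n) (lo hi : Fin n) (d : ℕ) → toℕ lo + d ≡ toℕ hi →
  countIn S lo hi ≡ sum (applyUpTo (χ S ∘ (toℕ lo +_)) (suc d))
countIn-window {n} S lo hi d lo+d≡hi = begin
    ∣ S ∩ I ∣
  ≡⟨ ∣p∣≡sum-χ (S ∩ I) ⟩
    sum (applyUpTo (χ (S ∩ I)) n)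
  ≡⟨ sum-applyUpTo-support (χ (S ∩ I)) l (suc d) fits below above ⟩
    sum (applyUpTo (χ (S ∩ I) ∘ (l +_)) (suc d))
  ≡⟨ cong sum (applyUpTo-cong (suc d) within) ⟩
    sum (applyUpTo (χ S ∘ (l +_)) (suc d)) ∎
  where
  open ≡-Reasoning
  I = interval lo hi
  l = toℕ lo

  l+1+d≡1+hi : l + suc d ≡ suc (toℕ hi)
  l+1+d≡1+hi = trans (+-suc l d) (cong suc lo+d≡hi)

  fits : l + suc d ℕ.≤ n
  fits = ≤-trans (≤-reflexive l+1+d≡1+hi) (toℕ<n hi)

  χ-outside : ∀ {k} → k ∈ᵇ I ≡ false → χ (S ∩ I) k ≡ 0
  χ-outside {k} k∉I = trans (χ-∩ S I k) (cong (if_then χ S k else 0) k∉I)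

  below : ∀ k → k ℕ.< l → χ (S ∩ I) k ≡ 0
  below k k<l = χ-outside (∈ᵇ-interval-below lo hi k<l)

  above : ∀ k → l + suc d ℕ.≤ k → k ℕ.< n → χ (S ∩ I) k ≡ 0
  above k l+1+d≤k k<n = χ-outside
    (∈ᵇ-interval-above lo hi (≤-trans (≤-reflexive (sym l+1+d≡1+hi)) l+1+d≤k) k<n)

  within : ∀ i → i ℕ.< suc d → χ (S ∩ I) (l + i) ≡ χ S (l + i)
  within i (s≤s i≤d) = trans (χ-∩ S I (l + i)) (cong (if_then χ S (l + i) else 0)
    (∈ᵇ-interval-inside lo hi (m≤m+n l i)
      (subst (l + i ℕ.≤_) lo+d≡hi (+-monoʳ-≤ l i≤d))))

Adj-sym : {n : ℕ} (a : HankelEntries n) (i j : Fin n) → Adj {n} a i j → Adj {n} a j i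
Adj-sym {n} a i j = subst (InT {n} a) (+-comm (toℕ i) (toℕ j))

module Component {n : ℕ} (a : HankelEntries n) {u : Fin n} {VC : Subset n}
                 (VC-component : ∀ k → (k ∈ VC) ⇔ Connected {n} a u k) where

  ∈-Adj : {i j : Fin n} → Adj {n} a i j → i ∈ VC → j ∈ VC
  ∈-Adj {i} {j} i~j i∈VC =
    Equivalence.from (VC-component j) (Equivalence.to (VC-component i) i∈VC ◅◅ return i~j)

  ∈ᵇ-Adj : ∀ {k k'} (k<n : k ℕ.< n) (k'<n : k' ℕ.< n) →
    Adj {n} a (fromℕ< k<n) (fromℕ< k'<n) → k ∈ᵇ VC ≡ true → k' ∈ᵇ VC ≡ true
  ∈ᵇ-Adj k<n k'<n k~k' =
    Equivalence.to (∈⇔∈ᵇ VC k'<n) ∘ ∈-Adj k~k' ∘ Equivalence.from (∈⇔∈ᵇ VC k<n)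

  ∈ᵇ-mirror : ∀ {k k'} → InT {n} a (k + k') → k ℕ.< n → k' ℕ.< n → k ∈ᵇ VC ≡ k' ∈ᵇ VC
  ∈ᵇ-mirror s∈T k<n k'<n = ⇔→≡ (mk⇔ (∈ᵇ-Adj k<n k'<n k~k')
    (∈ᵇ-Adj k'<n k<n (Adj-sym a (fromℕ< k<n) (fromℕ< k'<n) k~k')))
    where
    k~k' : Adj {n} a (fromℕ< k<n) (fromℕ< k'<n)
    k~k' = subst (InT {n} a) (sym (cong₂ _+_ (toℕ-fromℕ< k<n) (toℕ-fromℕ< k'<n))) s∈T

  countIn-mirror : (lo hi lo' hi' : Fin n) (d : ℕ) →
    toℕ lo + d ≡ toℕ hi → toℕ lo' + d ≡ toℕ hi' → InT {n} a (toℕ lo + toℕ hi') →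
    countIn VC lo hi ≡ countIn VC lo' hi'
  countIn-mirror lo hi lo' hi' d lo+d≡hi lo'+d≡hi' s∈T = begin
      countIn VC lo hi
    ≡⟨ countIn-window VC lo hi d lo+d≡hi ⟩
      sum (applyUpTo (χ VC ∘ (l +_)) (suc d))
    ≡⟨ cong sum (applyUpTo-cong (suc d) reflect) ⟩
      sum (applyUpTo (λ i → χ VC (l' + (d ∸ i))) (suc d))
    ≡⟨ sym (sum-applyUpTo-reverse (χ VC ∘ (l' +_)) (suc d)) ⟩
      sum (applyUpTo (χ VC ∘ (l' +_)) (suc d))
    ≡⟨ sym (countIn-window VC lo' hi' d lo'+d≡hi') ⟩
      countIn VC lo' hi' ∎
    where
    open ≡-Reasoning
    l  = toℕ lo
    l' = toℕ lo'

    rearrange : ∀ w x y z → w + (x + (y + z)) ≡ w + z + (x + y)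
    rearrange = solve-∀

    reflect : ∀ i → i ℕ.< suc d → χ VC (l + i) ≡ χ VC (l' + (d ∸ i))
    reflect i (s≤s i≤d) =
      cong (if_then 1 else 0) (∈ᵇ-mirror (subst (InT {n} a) pair-sum s∈T) k<n k'<n)
      where
      pair-sum : l + toℕ hi' ≡ (l + i) + (l' + (d ∸ i))
      pair-sum = begin
          l + toℕ hi'
        ≡⟨ cong (l +_) (sym lo'+d≡hi') ⟩
          l + (l' + d)
        ≡⟨ cong (λ e → l + (l' + e)) (sym (m∸n+n≡m i≤d)) ⟩
          l + (l' + (d ∸ i + i))
        ≡⟨ rearrange l l' (d ∸ i) i ⟩
          (l + i) + (l' + (d ∸ i)) ∎
      k<n : l + i ℕ.< n
      k<n = ≤-<-trans (subst (l + i ℕ.≤_) lo+d≡hi (+-monoʳ-≤ l i≤d)) (toℕ<n hi)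
      k'<n : l' + (d ∸ i) ℕ.< n
      k'<n = ≤-<-trans (subst (l' + (d ∸ i) ℕ.≤_) lo'+d≡hi' (+-monoʳ-≤ l' (m∸n≤m d i)))
                       (toℕ<n hi')

lemma4p1 : (n : ℕ) (a : HankelEntries n) (u₁ u₂ v₁ v₂ : Fin n)
    → (VC : Subset n) → (∀ k → (k ∈ VC) ⇔ Connected {n} a u₁ k)
    → u₁ ∈ VC → u₂ ∈ VC → v₁ ∈ VC → v₂ ∈ VC
    → toℕ u₁ + toℕ v₁ ≡ toℕ u₂ + toℕ v₂
    → InT {n} a (toℕ u₁ + toℕ v₁)
    → v₂ ≤ v₁ → v₁ ≤ u₁ → u₁ ≤ u₂
    → countIn VC u₁ u₂ ≡ countIn VC v₂ v₁
lemma4p1 n a u₁ u₂ v₁ v₂ VC VC-component _ _ _ _ u₁+v₁≡u₂+v₂ s∈T _ _ u₁≤u₂ =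
  countIn-mirror u₁ u₂ v₂ v₁ d u₁+d≡u₂ v₂+d≡v₁ s∈T
  where
  open Component a VC-component
  open ≡-Reasoning
  d = toℕ u₂ ∸ toℕ u₁

  u₁+d≡u₂ : toℕ u₁ + d ≡ toℕ u₂
  u₁+d≡u₂ = m+[n∸m]≡n u₁≤u₂

  swap : ∀ x y z → x + (y + z) ≡ x + z + y
  swap = solve-∀

  v₂+d≡v₁ : toℕ v₂ + d ≡ toℕ v₁
  v₂+d≡v₁ = +-cancelˡ-≡ (toℕ u₁) _ _ (begin
      toℕ u₁ + (toℕ v₂ + d)  ≡⟨ swap (toℕ u₁) (toℕ v₂) d ⟩
      toℕ u₁ + d + toℕ v₂    ≡⟨ cong (_+ toℕ v₂) u₁+d≡u₂ ⟩
      toℕ u₂ + toℕ v₂        ≡⟨ sym u₁+v₁≡u₂+v₂ ⟩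
      toℕ u₁ + toℕ v₁        ∎)
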